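{- If $M'$ is a minor of a finite matroid $M$, then $\mathrm{bd}(M')\le\mathrm{bd}(M)$.
   Context: Depth of a rooted tree: the number of edges of a longest root-to-leaf path; $\|T\|$ is the number of edges of $T$. A depth-decomposition of a finite matroid $M$ with rank function $r$ is a pair $(T,f)$, $T$ a rooted tree, $f:M\to V(T)$, such that (1) $r(M)=\|T\|$ and (2) $r(X)\le\|T^*(X)\|$ for all $X\subseteq M$, where $T^*(X)$ is the union of the paths from the root to the vertices of $f(X)$. The branch-depth $\mathrm{bd}(M)$ is the smallest depth of a rooted tree $T$ for which some $(T,f)$ is a depth-decomposition of $M$. -}

module Defs where

open import Data.Nat using (ℕ; zero; suc; _+_; _∸_; _≤_; _⊔_)
open import Data.Bool using (Bool; true; false; _∧_)
open import Data.Fin using (Fin; zero; suc; toℕ; _≟_)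
open import Data.Fin.Subset using (Subset; _⊆_; _∪_; _∩_; _─_; ∣_∣; ⊤; ⊥)
open import Data.List using (List; allFin; foldr; map)
open import Data.Bool.ListAction using (any)
open import Data.Vec using (tabulate; lookup)
open import Data.Product using (Σ; _×_; _,_)
open import Relation.Binary.PropositionalEquality using (_≡_)
open import Relation.Nullary.Decidable using (⌊_⌋)

-- Finite matroids, given by their rank function.
-- The ground set E is a subset of Fin n; the rank function r is only
-- relevant (and only constrained) on subsets of E.

record Matroid (n : ℕ) : Set where
  field
    E  : Subset n
    r  : Subset n → ℕ
    R1 : ∀ X → X ⊆ E → r X ≤ ∣ X ∣
    R2 : ∀ X Y → X ⊆ Y → Y ⊆ E → r X ≤ r Y
    R3 : ∀ X Y → X ⊆ E → Y ⊆ E → r (X ∪ Y) + r (X ∩ Y) ≤ r X + r Y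

open Matroid public

-- M' is a minor of M:  M' = (M \ D) / C  for disjoint C, D ⊆ E(M).
-- The ground set of M' is E(M) - (C ∪ D) and its rank function is
-- r'(X) = r(X ∪ C) - r(C) for X ⊆ E(M').
IsMinor : ∀ {n} → Matroid n → Matroid n → Set
IsMinor {n} M' M =
  Σ (Subset n) λ C → Σ (Subset n) λ D →
    C ⊆ E M × D ⊆ E M × (C ∩ D ≡ ⊥) ×
    (E M' ≡ E M ─ (C ∪ D)) ×
    (∀ X → X ⊆ E M' → r M' X ≡ r M (X ∪ C) ∸ r M C)

-- Vertices are Fin (suc m), the root is
-- zero, and the non-root vertex  suc i  has parent  parent i, whose
-- label is smaller than suc i.  Every finite rooted tree has such a
-- labelling (e.g. BFS order), and ‖T‖ = m.

record RootedTree (m : ℕ) : Set where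
  field
    parent  : Fin m → Fin (suc m)
    parent< : ∀ i → toℕ (parent i) ≤ toℕ i

open RootedTree public

parentOf : ∀ {m} → RootedTree m → Fin (suc m) → Fin (suc m)
parentOf T zero    = zero
parentOf T (suc i) = parent T i

-- k-th ancestor (the root is its own parent)
anc : ∀ {m} → RootedTree m → ℕ → Fin (suc m) → Fin (suc m)
anc T zero    v = v
anc T (suc k) v = anc T k (parentOf T v)

isRoot : ∀ {m} → Fin (suc m) → Bool
isRoot zero    = true
isRoot (suc _) = false

notRoot : ∀ {m} → Fin (suc m) → Bool
notRoot zero    = false
notRoot (suc _) = true

countTrue : List Bool → ℕ
countTrue = foldr (λ b n → if′ b n) 0
  where
    if′ : Bool → ℕ → ℕ
    if′ true  n = suc n
    if′ false n = n

-- distance from v to the root (the ancestors of v are strictly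
-- decreasing, so the root is reached within m steps)
vdepth : ∀ {m} → RootedTree m → Fin (suc m) → ℕ
vdepth {m} T v = countTrue (map (λ k → notRoot (anc T (toℕ k) v)) (allFin m))

depth : ∀ {m} → RootedTree m → ℕ
depth {m} T = foldr _⊔_ 0 (map (vdepth T) (allFin (suc m)))

onRootPath : ∀ {m} → RootedTree m → Fin (suc m) → Fin (suc m) → Bool
onRootPath {m} T u v = any (λ k → ⌊ anc T (toℕ k) v ≟ u ⌋) (allFin (suc m))

-- ‖T*(X)‖ : the number of edges of the union of the root paths to the
-- vertices f(x), x ∈ X.  Edges correspond bijectively to non-root
-- vertices (edge to the parent), so we count the non-root vertices
-- lying on such a path.
starEdges : ∀ {n m} → RootedTree m → (Fin n → Fin (suc m)) → Subset n → ℕ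
starEdges {n} {m} T f X =
  ∣ tabulate (λ (u : Fin m) →
      any (λ x → lookup X x ∧ onRootPath T (suc u) (f x)) (allFin n)) ∣

-- (T , f) is a depth-decomposition of M  (f is only relevant on E(M))
IsDepthDecomposition : ∀ {n m} → Matroid n → RootedTree m →
                       (Fin n → Fin (suc m)) → Set
IsDepthDecomposition {n} {m} M T f =
  (r M (E M) ≡ m) × (∀ X → X ⊆ E M → r M X ≤ starEdges T f X)

IsBranchDepth : ∀ {n} → Matroid n → ℕ → Set
IsBranchDepth {n} M d =
  (Σ ℕ λ m → Σ (RootedTree m) λ T → Σ (Fin n → Fin (suc m)) λ f →
     IsDepthDecomposition M T f × depth T ≡ d)
  × (∀ m (T : RootedTree m) (f : Fin n → Fin (suc m)) →
       IsDepthDecomposition M T f → d ≤ depth T)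

-- A depth-decomposition is carried through the minor one element at a
-- time; the minor (M / A) | G is represented by the pair (A , G).  To
-- contract e ∈ G: if e is a loop of M / A, the decomposition (T , f) still
-- works.  Otherwise f e is not the root, and contracting the tree edge
-- above f e lowers ‖T‖ by one, matching the drop in rank.  The bound
-- r(X) ≤ ‖T*(X)‖ survives: if the contracted edge lies in T*(X), it already
-- reaches f e, so adding e to X adds no edge; otherwise contraction leaves
-- ‖T*(X)‖ unchanged.  To delete e: if e is not a coloop, (T , f) still
-- works, and deleting a coloop is the same as contracting it.  Contracting C
-- and then deleting D yields M' without increasing the depth.

module Submission where

open import Defs
open import Data.Bool using (Bool; true; false; T; _∧_)
open import Data.Bool.ListAction using (any)
open import Data.Bool.Properties using (T-≡; T-∧)
open import Data.Empty using (⊥-elim)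
open import Data.Fin using (Fin; zero; suc; toℕ; fromℕ<; _≟_; punchIn; punchOut)
open import Data.Fin.Subset using (Subset; _∈_; _∉_; _⊆_; _∪_; _∩_; _─_; ⁅_⁆; ∣_∣; ⊥; inside; outside)
open import Data.Fin.Subset.Properties
  using (_∈?_; ⊆-antisym; ⊆-trans; ⊥⊆; ∪-comm; ∪-assoc; ∪-identityˡ
    ; ∪-identityʳ; p─⊥≡p; p─q─r≡p─q∪r; x∈p∩q⁺; p∩q⊆p; ∣⁅x⁆∣≡1; p⊆p∪q; q⊆p∪q
    ; x∈p∪q⁻; x∈⁅x⁆; x∈⁅y⁆⇒x≡y; p─q⊆p; x∈p∧x∉q⇒x∈p─q; ∣⊥∣≡0; p⊆q⇒∣p∣≤∣q∣)
open import Data.Vec using (_∷_; here; there; lookup; removeAt)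
import Data.Vec as Vec
open import Data.Vec.Properties using ([]=⇒lookup; lookup⇒[]=; lookup∘tabulate)
import Data.Fin.Properties as Fin
open import Data.List using ([]; _∷_; allFin; tabulate)
open import Data.List.Membership.Propositional using (lose) renaming (_∈_ to _∈ₗ_)
open import Data.List.Membership.Propositional.Properties using (∈-allFin)
open import Data.List.Properties using (map-tabulate; foldr-preservesᵇ; foldr-preservesᵒ)
import Data.List.Relation.Unary.All.Properties as AllP
open import Data.List.Relation.Unary.Any as Any using (satisfied)
import Data.List.Relation.Unary.Any.Properties as AnyP
open import Data.Nat using (ℕ; zero; suc; _+_; _∸_; _≤_; _<_; _⊓_; z≤n; s≤s; _≤?_) renaming (_≟_ to _≟ℕ_)
open import Data.Nat.Properties
  using (≤-refl; ≤-trans; +-cancelʳ-≡; m+n∸n≡m; m≤n+o⇒m∸n≤o; +-identityʳ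
    ; +-assoc; +-suc; +-monoˡ-≤; module ≤-Reasoning; ≤-antisym; ≤∧≢⇒<; m≤m+n
    ; +-comm; +-monoʳ-≤; +-cancelʳ-≤; n≤1+n; n≤0⇒n≡0; 1+n≰n; m≤n⇒m≤1+n; ≤-pred
    ; ≰⇒>; <⇒≱; m≤n⇒m≤n⊔o; m≤n⇒m≤o⊔n; ⊔-lub; m⊓n≤n; m≤n⇒m⊓n≡m; m≥n⇒m⊓n≡n; ≰⇒≥)
open import Data.Product using (∃-syntax; _×_; _,_)
open import Data.Sum using (_⊎_; inj₁; inj₂; [_,_]′)
open import Function using (_∘_; id; case_of_)
open import Function.Bundles using (Equivalence)
open import Relation.Binary.PropositionalEquality
open import Relation.Nullary using (¬_; Dec; yes; no; _×-dec_)
open import Relation.Nullary.Decidable using (⌊_⌋; toWitness; fromWitness)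

-- Boolean sequences and subsets

module _ {n : ℕ} (p : Fin n → Bool) where

  any-allFin⁻ : T (any p (allFin n)) → ∃[ i ] T (p i)
  any-allFin⁻ t = satisfied (AnyP.any⁻ p (allFin n) t)

  any-allFin⁺ : ∀ i → T (p i) → T (any p (allFin n))
  any-allFin⁺ i t = AnyP.any⁺ p (lose (∈-allFin i) t)

Antitone : (ℕ → Bool) → Set
Antitone Q = ∀ k → Q (suc k) ≡ true → Q k ≡ true

antitone-false : ∀ {Q} → Antitone Q → Q 0 ≡ false → ∀ k → Q k ≡ false
antitone-false anti Q0≡false zero    = Q0≡false
antitone-false {Q} anti Q0≡false (suc k) with Q (suc k) in Qk+1≡
... | false = refl
... | true with () ← trans (sym (anti k Qk+1≡)) (antitone-false anti Q0≡false k)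

countTrue-false : ∀ {N} (h : Fin N → Bool) → (∀ i → h i ≡ false) → countTrue (tabulate h) ≡ 0
countTrue-false {zero}  h h≡false = refl
countTrue-false {suc N} h h≡false rewrite h≡false zero = countTrue-false (h ∘ suc) (h≡false ∘ suc)

countTrue-antitone-≤ : ∀ N {Q} → Antitone Q → ∀ l → Q l ≡ false →
                       countTrue (tabulate {n = N} (Q ∘ toℕ)) ≤ l
countTrue-antitone-≤ zero anti l Ql≡false = z≤n
countTrue-antitone-≤ (suc N) {Q} anti l Ql≡false with Q 0 in Q0≡
... | false rewrite countTrue-false {N} _ (antitone-false anti Q0≡ ∘ suc ∘ toℕ) = z≤n
... | true with l
...   | zero with () ← trans (sym Q0≡) Ql≡false
...   | suc l = s≤s (countTrue-antitone-≤ N (anti ∘ suc) l Ql≡false)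

countTrue-antitone-false : ∀ N {Q} → Antitone Q → Q N ≡ false →
                           Q (countTrue (tabulate {n = N} (Q ∘ toℕ))) ≡ false
countTrue-antitone-false zero anti QN≡false = QN≡false
countTrue-antitone-false (suc N) {Q} anti QN≡false with Q 0 in Q0≡
... | false rewrite countTrue-false {N} _ (antitone-false anti Q0≡ ∘ suc ∘ toℕ) = Q0≡
... | true = countTrue-antitone-false N (anti ∘ suc) QN≡false

∈⇒T-lookup : ∀ {n} {p : Subset n} {x} → x ∈ p → T (lookup p x)
∈⇒T-lookup x∈p = Equivalence.from T-≡ ([]=⇒lookup x∈p)

T-lookup⇒∈ : ∀ {n} {p : Subset n} {x} → T (lookup p x) → x ∈ p
T-lookup⇒∈ {p = p} {x} t = lookup⇒[]= x p (Equivalence.to T-≡ t)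

∈-tabulate⁻ : ∀ {n} {h : Fin n → Bool} {x} → x ∈ Vec.tabulate h → T (h x)
∈-tabulate⁻ {h = h} {x} x∈ = subst T (lookup∘tabulate h x) (∈⇒T-lookup x∈)

∈-tabulate⁺ : ∀ {n} {h : Fin n → Bool} {x} → T (h x) → x ∈ Vec.tabulate h
∈-tabulate⁺ {h = h} {x} t = T-lookup⇒∈ (subst T (sym (lookup∘tabulate h x)) t)

∈-removeAt⁻ : ∀ {n} {p : Subset (suc n)} j {i} → i ∈ removeAt p j → punchIn j i ∈ p
∈-removeAt⁻ {p = _ ∷ _}     zero             i∈ = there i∈
∈-removeAt⁻ {p = _ ∷ _ ∷ _} (suc j) {zero}  here      = here
∈-removeAt⁻ {p = _ ∷ _ ∷ _} (suc j) {suc i} (there i∈) = there (∈-removeAt⁻ j i∈)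

∣p∣≤1+∣removeAt∣ : ∀ {n} (p : Subset (suc n)) j → ∣ p ∣ ≤ suc ∣ removeAt p j ∣
∣p∣≤1+∣removeAt∣ (outside ∷ p)     zero    = n≤1+n ∣ p ∣
∣p∣≤1+∣removeAt∣ (inside  ∷ p)     zero    = ≤-refl
∣p∣≤1+∣removeAt∣ (outside ∷ y ∷ p) (suc j) = ∣p∣≤1+∣removeAt∣ (y ∷ p) j
∣p∣≤1+∣removeAt∣ (inside  ∷ y ∷ p) (suc j) = s≤s (∣p∣≤1+∣removeAt∣ (y ∷ p) j)

∣p∣≤∣removeAt∣ : ∀ {n} (p : Subset (suc n)) j → j ∉ p → ∣ p ∣ ≤ ∣ removeAt p j ∣
∣p∣≤∣removeAt∣ (outside ∷ p)     zero    j∉p = ≤-refl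
∣p∣≤∣removeAt∣ (inside  ∷ p)     zero    j∉p = ⊥-elim (j∉p here)
∣p∣≤∣removeAt∣ (outside ∷ y ∷ p) (suc j) j∉p = ∣p∣≤∣removeAt∣ (y ∷ p) j (j∉p ∘ there)
∣p∣≤∣removeAt∣ (inside  ∷ y ∷ p) (suc j) j∉p = s≤s (∣p∣≤∣removeAt∣ (y ∷ p) j (j∉p ∘ there))

x∈p─q⇒x∉q : ∀ {n} (p q : Subset n) {x} → x ∈ p ─ q → x ∉ q
x∈p─q⇒x∉q (_ ∷ p) (outside ∷ q) here       ()
x∈p─q⇒x∉q (_ ∷ p) (_       ∷ q) (there x∈) (there x∈q) = x∈p─q⇒x∉q p q x∈ x∈q

module _ {n : ℕ} where

  ∪-least : ∀ {p q s : Subset n} → p ⊆ s → q ⊆ s → p ∪ q ⊆ s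
  ∪-least {p} {q} p⊆s q⊆s x∈ = [ p⊆s , q⊆s ]′ (x∈p∪q⁻ p q x∈)

  ⁅⁆⊆ : ∀ {p : Subset n} {e} → e ∈ p → ⁅ e ⁆ ⊆ p
  ⁅⁆⊆ {p} {e} e∈p x∈ = subst (_∈ p) (sym (x∈⁅y⁆⇒x≡y e x∈)) e∈p

  q⊆p⇒p∪q≡p : ∀ {p q : Subset n} → q ⊆ p → p ∪ q ≡ p
  q⊆p⇒p∪q≡p q⊆p = ⊆-antisym (∪-least id q⊆p) (p⊆p∪q _)

  [p─⁅e⁆]∪⁅e⁆≡p : ∀ {p : Subset n} {e} → e ∈ p → (p ─ ⁅ e ⁆) ∪ ⁅ e ⁆ ≡ p
  [p─⁅e⁆]∪⁅e⁆≡p {p} {e} e∈p = ⊆-antisym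
    (∪-least (p─q⊆p p ⁅ e ⁆) (⁅⁆⊆ e∈p))
    λ {x} x∈p → case x ≟ e of λ where
      (yes refl) → q⊆p∪q _ _ (x∈⁅x⁆ x)
      (no x≢e)   → p⊆p∪q _ (x∈p∧x∉q⇒x∈p─q x∈p (x≢e ∘ x∈⁅y⁆⇒x≡y e))

  ─-disjoint : ∀ {p q : Subset n} → (∀ {x} → x ∈ p → x ∉ q) → p ─ q ≡ p
  ─-disjoint {p} {q} p∩q≡∅ = ⊆-antisym (p─q⊆p p q) (λ x∈p → x∈p∧x∉q⇒x∈p─q x∈p (p∩q≡∅ x∈p))

  [p─q]∪⁅e⁆≡p─[q─⁅e⁆] : ∀ {p q : Subset n} {e} → q ⊆ p → e ∈ q → (p ─ q) ∪ ⁅ e ⁆ ≡ p ─ (q ─ ⁅ e ⁆)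
  [p─q]∪⁅e⁆≡p─[q─⁅e⁆] {p} {q} {e} q⊆p e∈q = ⊆-antisym
    (∪-least (λ x∈ → x∈p∧x∉q⇒x∈p─q (p─q⊆p p q x∈) (x∈p─q⇒x∉q p q x∈ ∘ p─q⊆p q ⁅ e ⁆))
             (λ x∈ → x∈p∧x∉q⇒x∈p─q (q⊆p (⁅⁆⊆ e∈q x∈)) (λ x∈q─e → x∈p─q⇒x∉q q ⁅ e ⁆ x∈q─e x∈)))
    λ {x} x∈ → case x ≟ e of λ where
      (yes refl) → q⊆p∪q _ _ (x∈⁅x⁆ x)
      (no x≢e)   → p⊆p∪q _ (x∈p∧x∉q⇒x∈p─q (p─q⊆p p _ x∈)
                     λ x∈q → x∈p─q⇒x∉q p _ x∈ (x∈p∧x∉q⇒x∈p─q x∈q (x≢e ∘ x∈⁅y⁆⇒x≡y e)))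

  p─[p─q]≡q : ∀ {p q : Subset n} → q ⊆ p → p ─ (p ─ q) ≡ q
  p─[p─q]≡q {p} {q} q⊆p = ⊆-antisym
    (λ {x} x∈ → case x ∈? q of λ where
      (yes x∈q) → x∈q
      (no x∉q)  → ⊥-elim (x∈p─q⇒x∉q p _ x∈ (x∈p∧x∉q⇒x∈p─q (p─q⊆p p _ x∈) x∉q)))
    (λ x∈q → x∈p∧x∉q⇒x∈p─q (q⊆p x∈q) (λ x∈p─q → x∈p─q⇒x∉q p q x∈p─q x∈q))

─-rec : ∀ {n} (S : Subset n) (P : Subset n → Set) →
        (∀ {G e} → e ∈ G → e ∈ S → P G → P (G ─ ⁅ e ⁆)) → ∀ {G} → P G → P (G ─ S)
─-rec {n} S P step = go (allFin n) (λ {x} _ _ → ∈-allFin x)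
  where
  go : ∀ xs {G} → (∀ {x} → x ∈ G → x ∈ S → x ∈ₗ xs) → P G → P (G ─ S)
  go [] G∩S⊆[] PG = subst P (sym (─-disjoint λ x∈G x∈S → case G∩S⊆[] x∈G x∈S of λ ())) PG
  go (e ∷ xs) {G} G∩S⊆e∷xs PG with e ∈? G ×-dec e ∈? S
  ... | yes (e∈G , e∈S) = subst P G─e─S≡G─S (go xs G─e∩S⊆xs (step e∈G e∈S PG))
    where
    G─e─S≡G─S : G ─ ⁅ e ⁆ ─ S ≡ G ─ S
    G─e─S≡G─S = trans (p─q─r≡p─q∪r G ⁅ e ⁆ S)
                      (cong (G ─_) (trans (∪-comm ⁅ e ⁆ S) (q⊆p⇒p∪q≡p (⁅⁆⊆ e∈S))))
    G─e∩S⊆xs : ∀ {x} → x ∈ G ─ ⁅ e ⁆ → x ∈ S → x ∈ₗ xs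
    G─e∩S⊆xs x∈ x∈S with G∩S⊆e∷xs (p─q⊆p G ⁅ e ⁆ x∈) x∈S
    ... | Any.here refl  = ⊥-elim (x∈p─q⇒x∉q G ⁅ e ⁆ x∈ (x∈⁅x⁆ e))
    ... | Any.there x∈xs = x∈xs
  ... | no e∉G∩S = go xs G∩S⊆xs PG
    where
    G∩S⊆xs : ∀ {x} → x ∈ G → x ∈ S → x ∈ₗ xs
    G∩S⊆xs x∈G x∈S with G∩S⊆e∷xs x∈G x∈S
    ... | Any.here refl  = ⊥-elim (e∉G∩S (x∈G , x∈S))
    ... | Any.there x∈xs = x∈xs

-- Rooted trees

module _ {m : ℕ} (τ : RootedTree m) where

  Ancestor : Fin (suc m) → Fin (suc m) → Set
  Ancestor u v = ∃[ k ] anc τ k v ≡ u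

  anc-root : ∀ k → anc τ k zero ≡ zero
  anc-root zero    = refl
  anc-root (suc k) = anc-root k

  anc-+ : ∀ a b v → anc τ (a + b) v ≡ anc τ b (anc τ a v)
  anc-+ zero    b v = refl
  anc-+ (suc a) b v = anc-+ a b (parentOf τ v)

  anc-suc : ∀ k v → anc τ (suc k) v ≡ parentOf τ (anc τ k v)
  anc-suc zero    v = refl
  anc-suc (suc k) v = anc-suc k (parentOf τ v)

  anc-≥ : ∀ l v → toℕ v ≤ l → anc τ l v ≡ zero
  anc-≥ zero    zero    _         = refl
  anc-≥ (suc l) zero    _         = anc-root l
  anc-≥ (suc l) (suc i) (s≤s i≤l) = anc-≥ l (parent τ i) (≤-trans (parent< τ i) i≤l)

  anc-⊓ : ∀ k v → anc τ (k ⊓ m) v ≡ anc τ k v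
  anc-⊓ k v with k ≤? m
  ... | yes k≤m = cong (λ l → anc τ l v) (m≤n⇒m⊓n≡m k≤m)
  ... | no  k≰m = begin
    anc τ (k ⊓ m) v ≡⟨ cong (λ l → anc τ l v) (m≥n⇒m⊓n≡n (≰⇒≥ k≰m)) ⟩
    anc τ m v       ≡⟨ anc-≥ m v v≤m ⟩
    zero            ≡⟨ anc-≥ k v (≤-trans v≤m (≰⇒≥ k≰m)) ⟨
    anc τ k v       ∎
    where
    open ≡-Reasoning
    v≤m : toℕ v ≤ m
    v≤m = Fin.toℕ≤pred[n] v

  onRootPath⁻ : ∀ {u v} → T (onRootPath τ u v) → Ancestor u v
  onRootPath⁻ {u} {v} t with any-allFin⁻ {suc m} (λ k → ⌊ anc τ (toℕ k) v ≟ u ⌋) t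
  ... | k , anc≡u = toℕ k , toWitness anc≡u

  onRootPath⁺ : ∀ {u v} → Ancestor u v → T (onRootPath τ u v)
  onRootPath⁺ {u} {v} (k , anc≡u) =
    any-allFin⁺ {suc m} (λ k → ⌊ anc τ (toℕ k) v ≟ u ⌋) i (fromWitness (begin
      anc τ (toℕ i) v ≡⟨ cong (λ l → anc τ l v) (Fin.toℕ-fromℕ< k⊓m<1+m) ⟩
      anc τ (k ⊓ m) v ≡⟨ anc-⊓ k v ⟩
      anc τ k v       ≡⟨ anc≡u ⟩
      _               ∎))
    where
    open ≡-Reasoning
    k⊓m<1+m : k ⊓ m < suc m
    k⊓m<1+m = s≤s (m⊓n≤n k m)
    i : Fin (suc m)
    i = fromℕ< k⊓m<1+m

  notRoot-anc-antitone : ∀ v → Antitone (λ l → notRoot (anc τ l v))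
  notRoot-anc-antitone v k notRoot≡true with anc τ k v in anc≡
  ... | suc _ = refl
  ... | zero rewrite anc-suc k v | anc≡ with () ← notRoot≡true

  notRoot≡false : ∀ {w : Fin (suc m)} → notRoot w ≡ false → w ≡ zero
  notRoot≡false {zero} _ = refl

  vdepth≡countTrue : ∀ v → vdepth τ v ≡ countTrue (tabulate {n = m} (λ k → notRoot (anc τ (toℕ k) v)))
  vdepth≡countTrue v = cong countTrue (map-tabulate {n = m} id (λ k → notRoot (anc τ (toℕ k) v)))

  anc-vdepth : ∀ v → anc τ (vdepth τ v) v ≡ zero
  anc-vdepth v rewrite vdepth≡countTrue v = notRoot≡false
    (countTrue-antitone-false m (notRoot-anc-antitone v)
      (cong notRoot (anc-≥ m v (Fin.toℕ≤pred[n] v))))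

  vdepth-least : ∀ v l → anc τ l v ≡ zero → vdepth τ v ≤ l
  vdepth-least v l anc≡0 rewrite vdepth≡countTrue v =
    countTrue-antitone-≤ m (notRoot-anc-antitone v) l (cong notRoot anc≡0)

  vdepth≤depth : ∀ v → vdepth τ v ≤ depth τ
  vdepth≤depth v = foldr-preservesᵒ {P = vdepth τ v ≤_} (λ x y → [ m≤n⇒m≤n⊔o y , m≤n⇒m≤o⊔n x ]′) 0 _
    (inj₂ (AnyP.map⁺ (lose (∈-allFin v) ≤-refl)))

  depth-least : ∀ c → (∀ v → vdepth τ v ≤ c) → depth τ ≤ c
  depth-least c vdepth≤c = foldr-preservesᵇ {P = _≤ c} ⊔-lub z≤n (AllP.map⁺ (AllP.tabulate⁺ vdepth≤c))

module _ {n m : ℕ} (τ : RootedTree m) (f : Fin n → Fin (suc m)) where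

  -- starEdges τ f X is definitionally ∣ star X ∣.
  star : Subset n → Subset m
  star X = Vec.tabulate λ u → any (λ x → lookup X x ∧ onRootPath τ (suc u) (f x)) (allFin n)

  ∈-star⁻ : ∀ {X u} → u ∈ star X → ∃[ x ] x ∈ X × Ancestor τ (suc u) (f x)
  ∈-star⁻ {X} {u} u∈ with any-allFin⁻ (λ x → lookup X x ∧ onRootPath τ (suc u) (f x)) (∈-tabulate⁻ u∈)
  ... | x , t with Equivalence.to T-∧ t
  ...   | x∈X , onPath = x , T-lookup⇒∈ x∈X , onRootPath⁻ τ onPath

  ∈-star⁺ : ∀ {X u x} → x ∈ X → Ancestor τ (suc u) (f x) → u ∈ star X
  ∈-star⁺ {X} {u} {x} x∈X anc≡ = ∈-tabulate⁺
    (any-allFin⁺ (λ x → lookup X x ∧ onRootPath τ (suc u) (f x)) x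
      (Equivalence.from T-∧ (∈⇒T-lookup x∈X , onRootPath⁺ τ anc≡)))

  starEdges-root : ∀ {e} → f e ≡ zero → starEdges τ f ⁅ e ⁆ ≡ 0
  starEdges-root {e} fe≡0 = n≤0⇒n≡0 (subst (starEdges τ f ⁅ e ⁆ ≤_) (∣⊥∣≡0 m) (p⊆q⇒∣p∣≤∣q∣ star⊆⊥))
    where
    star⊆⊥ : star ⁅ e ⁆ ⊆ ⊥
    star⊆⊥ u∈ with ∈-star⁻ u∈
    ... | x , x∈⁅e⁆ , l , anc≡ with x∈⁅y⁆⇒x≡y e x∈⁅e⁆
    ... | refl with () ← trans (sym (trans (cong (anc τ l) fe≡0) (anc-root τ l))) anc≡

  star-absorb : ∀ {Y e u} → u ∈ star Y → f e ≡ suc u → star (Y ∪ ⁅ e ⁆) ⊆ star Y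
  star-absorb {Y} {e} u∈ fe≡ w∈ with ∈-star⁻ w∈
  ... | x , x∈ , anc-x with x∈p∪q⁻ Y ⁅ e ⁆ x∈
  ...   | inj₁ x∈Y = ∈-star⁺ x∈Y anc-x
  ...   | inj₂ x∈⁅e⁆ with x∈⁅y⁆⇒x≡y e x∈⁅e⁆ | ∈-star⁻ u∈ | anc-x
  ...     | refl | y , y∈Y , (k , anc-y) | (l , anc≡) =
    ∈-star⁺ {Y} y∈Y (k + l , trans (anc-+ τ k l (f y))
                                    (trans (cong (anc τ l) (trans anc-y (sym fe≡))) anc≡))

-- Contracting the edge between vertex suc j and its parent: φ merges suc j
-- into its parent and renumbers the remaining vertices by punchOut.
module EdgeContraction {k : ℕ} (τ : RootedTree (suc k)) (j : Fin (suc k)) where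

  parent≢ : suc j ≢ parent τ j
  parent≢ sj≡p = 1+n≰n (subst (λ v → toℕ v ≤ toℕ j) (sym sj≡p) (parent< τ j))

  merge : Fin (suc (suc k)) → Fin (suc (suc k))
  merge v with v ≟ suc j
  ... | yes _ = parent τ j
  ... | no  _ = v

  merge≢ : ∀ v → suc j ≢ merge v
  merge≢ v with v ≟ suc j
  ... | yes _   = parent≢
  ... | no  v≢ = v≢ ∘ sym

  merge-≤ : ∀ v → toℕ (merge v) ≤ toℕ v
  merge-≤ v with v ≟ suc j
  ... | yes refl = m≤n⇒m≤1+n (parent< τ j)
  ... | no  _    = ≤-refl

  merge-other : ∀ {v} → v ≢ suc j → merge v ≡ v
  merge-other {v} v≢ with v ≟ suc j
  ... | yes v≡ = ⊥-elim (v≢ v≡)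
  ... | no  _  = refl

  merge-suc-j : merge (suc j) ≡ parent τ j
  merge-suc-j with suc j ≟ suc j
  ... | yes _    = refl
  ... | no sj≢sj = ⊥-elim (sj≢sj refl)

  φ : Fin (suc (suc k)) → Fin (suc k)
  φ v = punchOut (merge≢ v)

  φ-merged : φ (suc j) ≡ φ (parent τ j)
  φ-merged = Fin.punchOut-cong (suc j) (trans merge-suc-j (sym (merge-other (parent≢ ∘ sym))))

  φ-punchIn : ∀ w → φ (punchIn (suc j) w) ≡ w
  φ-punchIn w = trans (Fin.punchOut-cong (suc j) (merge-other (Fin.punchInᵢ≢i (suc j) w)))
                      (Fin.punchOut-punchIn (suc j))

  merge-<⇒φ-< : ∀ v w → toℕ (merge v) < toℕ (merge w) → toℕ (φ v) < toℕ (φ w)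
  merge-<⇒φ-< v w lt = ≰⇒> λ φw≤φv → <⇒≱ lt (Fin.punchOut-cancel-≤ (merge≢ w) (merge≢ v) φw≤φv)

  contracted : RootedTree k
  contracted = record
    { parent  = λ i → φ (parent τ (punchIn j i))
    ; parent< = λ i → ≤-pred (subst (λ w → toℕ (φ (parent τ (punchIn j i))) < toℕ w) (φ-punchIn (suc i))
                                    (merge-<⇒φ-< (parent τ (punchIn j i)) (suc (punchIn j i)) (parent<merge i)))
    }
    where
    parent<merge : ∀ i → toℕ (merge (parent τ (punchIn j i))) < toℕ (merge (suc (punchIn j i)))
    parent<merge i rewrite merge-other (Fin.punchInᵢ≢i (suc j) (suc i)) =
      s≤s (≤-trans (merge-≤ _) (parent< τ (punchIn j i)))

  φ-parentOf : ∀ {v} → v ≢ suc j → φ (parentOf τ v) ≡ parentOf contracted (φ v)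
  φ-parentOf {zero}  _   = refl
  φ-parentOf {suc i} v≢ = begin
    φ (parent τ i)                            ≡⟨ cong (φ ∘ parent τ) i≡ ⟨
    φ (parent τ (punchIn j i'))               ≡⟨⟩
    parentOf contracted (suc i')              ≡⟨ cong (parentOf contracted) (φ-punchIn (suc i')) ⟨
    parentOf contracted (φ (suc (punchIn j i'))) ≡⟨ cong (parentOf contracted ∘ φ ∘ suc) i≡ ⟩
    parentOf contracted (φ (suc i))           ∎
    where
    open ≡-Reasoning
    j≢i : j ≢ i
    j≢i j≡i = v≢ (cong suc (sym j≡i))
    i' : Fin k
    i' = punchOut j≢i
    i≡ : punchIn j i' ≡ i
    i≡ = Fin.punchIn-punchOut j≢i

  φ∘parentOf : ∀ v → φ (parentOf τ v) ≡ φ v ⊎ φ (parentOf τ v) ≡ parentOf contracted (φ v)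
  φ∘parentOf v = case v ≟ suc j of λ where
    (yes refl) → inj₁ (sym φ-merged)
    (no v≢)    → inj₂ (φ-parentOf v≢)

  anc-φ : ∀ l v → ∃[ l' ] l' ≤ l × anc contracted l' (φ v) ≡ φ (anc τ l v)
  anc-φ zero    v = 0 , z≤n , refl
  anc-φ (suc l) v with anc-φ l (parentOf τ v) | φ∘parentOf v
  ... | l' , l'≤l , anc≡ | inj₁ merged =
    l' , m≤n⇒m≤1+n l'≤l , trans (cong (anc contracted l') (sym merged)) anc≡
  ... | l' , l'≤l , anc≡ | inj₂ commutes =
    suc l' , s≤s l'≤l , trans (cong (anc contracted l') (sym commutes)) anc≡

  vdepth-φ : ∀ v → vdepth contracted (φ v) ≤ vdepth τ v
  vdepth-φ v with anc-φ (vdepth τ v) v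
  ... | l' , l'≤ , anc≡ = ≤-trans (vdepth-least contracted (φ v) l' anc-φv≡0) l'≤
    where
    anc-φv≡0 : anc contracted l' (φ v) ≡ zero
    anc-φv≡0 = trans anc≡ (trans (cong φ (anc-vdepth τ v)) (φ-punchIn zero))

  depth-contracted : depth contracted ≤ depth τ
  depth-contracted = depth-least contracted (depth τ) λ w →
    subst (λ w′ → vdepth contracted w′ ≤ depth τ) (φ-punchIn w)
          (≤-trans (vdepth-φ (punchIn (suc j) w)) (vdepth≤depth τ _))

  module _ {n : ℕ} (f : Fin n → Fin (suc (suc k))) where

    removeAt-star⊆star : ∀ X → removeAt (star τ f X) j ⊆ star contracted (φ ∘ f) X
    removeAt-star⊆star X {u} u∈ with ∈-star⁻ τ f (∈-removeAt⁻ j u∈)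
    ... | x , x∈X , l , anc≡ with anc-φ l (f x)
    ...   | l' , _ , anc'≡ = ∈-star⁺ contracted (φ ∘ f) {X} x∈X
            (l' , trans anc'≡ (trans (cong φ anc≡) (φ-punchIn (suc u))))

    starEdges-contracted : ∀ X → starEdges τ f X ≤ suc (starEdges contracted (φ ∘ f) X)
    starEdges-contracted X = ≤-trans (∣p∣≤1+∣removeAt∣ (star τ f X) j)
                                     (s≤s (p⊆q⇒∣p∣≤∣q∣ (removeAt-star⊆star X)))

    starEdges-contracted-∉ : ∀ X → j ∉ star τ f X → starEdges τ f X ≤ starEdges contracted (φ ∘ f) X
    starEdges-contracted-∉ X j∉ = ≤-trans (∣p∣≤∣removeAt∣ (star τ f X) j j∉)
                                          (p⊆q⇒∣p∣≤∣q∣ (removeAt-star⊆star X))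

-- Matroids and depth-decompositions of minors

module _ {n : ℕ} (M : Matroid n) where

  open Matroid M using ()
    renaming (E to Eₘ; r to rk; R1 to rk≤∣∣; R2 to rk-mono; R3 to rk-submodular)

  rk-⊥ : rk ⊥ ≡ 0
  rk-⊥ = n≤0⇒n≡0 (subst (rk ⊥ ≤_) (∣⊥∣≡0 n) (rk≤∣∣ ⊥ ⊥⊆))

  rk-∪-⁅⁆-≤ : ∀ {A e} → A ⊆ Eₘ → e ∈ Eₘ → rk (A ∪ ⁅ e ⁆) ≤ suc (rk A)
  rk-∪-⁅⁆-≤ {A} {e} A⊆E e∈E = begin
    rk (A ∪ ⁅ e ⁆)                     ≤⟨ m≤m+n _ _ ⟩
    rk (A ∪ ⁅ e ⁆) + rk (A ∩ ⁅ e ⁆)    ≤⟨ rk-submodular A ⁅ e ⁆ A⊆E ⁅e⁆⊆E ⟩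
    rk A + rk ⁅ e ⁆                    ≤⟨ +-monoʳ-≤ (rk A) rk⁅e⁆≤1 ⟩
    rk A + 1                           ≡⟨ +-comm (rk A) 1 ⟩
    suc (rk A)                         ∎
    where
    open ≤-Reasoning
    ⁅e⁆⊆E : ⁅ e ⁆ ⊆ Eₘ
    ⁅e⁆⊆E = ⁅⁆⊆ e∈E
    rk⁅e⁆≤1 : rk ⁅ e ⁆ ≤ 1
    rk⁅e⁆≤1 = subst (rk ⁅ e ⁆ ≤_) (∣⁅x⁆∣≡1 e) (rk≤∣∣ ⁅ e ⁆ ⁅e⁆⊆E)

  Spans : Subset n → Subset n → Set
  Spans A Y = rk (A ∪ Y) ≡ rk A

  Spans-mono : ∀ {A B Y} → A ⊆ B → B ⊆ Eₘ → Y ⊆ Eₘ → Spans A Y → Spans B Y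
  Spans-mono {A} {B} {Y} A⊆B B⊆E Y⊆E A-spans =
    ≤-antisym rk[B∪Y]≤rk[B] (rk-mono B (B ∪ Y) (p⊆p∪q Y) B∪Y⊆E)
    where
    open ≤-Reasoning
    A∪Y⊆E : A ∪ Y ⊆ Eₘ
    A∪Y⊆E = ∪-least (⊆-trans A⊆B B⊆E) Y⊆E
    B∪Y⊆E : B ∪ Y ⊆ Eₘ
    B∪Y⊆E = ∪-least B⊆E Y⊆E
    B∪[A∪Y]≡B∪Y : B ∪ (A ∪ Y) ≡ B ∪ Y
    B∪[A∪Y]≡B∪Y = trans (sym (∪-assoc B A Y)) (cong (_∪ Y) (q⊆p⇒p∪q≡p A⊆B))
    A⊆B∩[A∪Y] : A ⊆ B ∩ (A ∪ Y)
    A⊆B∩[A∪Y] x∈A = x∈p∩q⁺ (A⊆B x∈A , p⊆p∪q Y x∈A)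
    B∩[A∪Y]⊆E : B ∩ (A ∪ Y) ⊆ Eₘ
    B∩[A∪Y]⊆E = ⊆-trans (p∩q⊆p B _) B⊆E
    rk[B∪Y]≤rk[B] : rk (B ∪ Y) ≤ rk B
    rk[B∪Y]≤rk[B] = +-cancelʳ-≤ (rk (B ∩ (A ∪ Y))) _ _ (begin
      rk (B ∪ Y) + rk (B ∩ (A ∪ Y))       ≡⟨ cong (λ Z → rk Z + rk (B ∩ (A ∪ Y))) B∪[A∪Y]≡B∪Y ⟨
      rk (B ∪ (A ∪ Y)) + rk (B ∩ (A ∪ Y)) ≤⟨ rk-submodular B (A ∪ Y) B⊆E A∪Y⊆E ⟩
      rk B + rk (A ∪ Y)                   ≡⟨ cong (rk B +_) A-spans ⟩
      rk B + rk A                         ≤⟨ +-monoʳ-≤ (rk B) (rk-mono A _ A⊆B∩[A∪Y] B∩[A∪Y]⊆E) ⟩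
      rk B + rk (B ∩ (A ∪ Y))             ∎)

  ¬Spans⇒rk-suc : ∀ {A e} → A ⊆ Eₘ → e ∈ Eₘ → ¬ Spans A ⁅ e ⁆ → rk (A ∪ ⁅ e ⁆) ≡ suc (rk A)
  ¬Spans⇒rk-suc {A} A⊆E e∈E ¬spans =
    ≤-antisym (rk-∪-⁅⁆-≤ A⊆E e∈E) (≤∧≢⇒< (rk-mono A _ (p⊆p∪q _) (∪-least A⊆E (⁅⁆⊆ e∈E))) (¬spans ∘ sym))

  -- (τ , f) is a depth-decomposition of the minor (M / A) | G, whose rank
  -- function X ↦ rk (X ∪ A) ∸ rk A appears with the subtraction cleared.
  record IsDecomposition (A G : Subset n) {m} (τ : RootedTree m) (f : Fin n → Fin (suc m)) : Set where
    field
      A⊆E    : A ⊆ Eₘ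
      G⊆E    : G ⊆ Eₘ
      rank   : m + rk A ≡ rk (G ∪ A)
      rank-≤ : ∀ X → X ⊆ G → rk (X ∪ A) ≤ starEdges τ f X + rk A

  record Decomposable (d : ℕ) (A G : Subset n) : Set where
    constructor decomposition
    field
      {edges}         : ℕ
      tree            : RootedTree edges
      label           : Fin n → Fin (suc edges)
      isDecomposition : IsDecomposition A G tree label
      depth≤          : depth tree ≤ d

  module _ {A G : Subset n} {e : Fin n} (e∈G : e ∈ G) where

    [G─e]∪[A∪e]≡G∪A : (G ─ ⁅ e ⁆) ∪ (A ∪ ⁅ e ⁆) ≡ G ∪ A
    [G─e]∪[A∪e]≡G∪A = begin
      (G ─ ⁅ e ⁆) ∪ (A ∪ ⁅ e ⁆) ≡⟨ cong ((G ─ ⁅ e ⁆) ∪_) (∪-comm A ⁅ e ⁆) ⟩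
      (G ─ ⁅ e ⁆) ∪ (⁅ e ⁆ ∪ A) ≡⟨ ∪-assoc (G ─ ⁅ e ⁆) ⁅ e ⁆ A ⟨
      ((G ─ ⁅ e ⁆) ∪ ⁅ e ⁆) ∪ A ≡⟨ cong (_∪ A) ([p─⁅e⁆]∪⁅e⁆≡p e∈G) ⟩
      G ∪ A                     ∎
      where open ≡-Reasoning

    contract-loop : ∀ {m} {τ : RootedTree m} {f} → IsDecomposition A G τ f → Spans A ⁅ e ⁆ →
                    IsDecomposition (A ∪ ⁅ e ⁆) (G ─ ⁅ e ⁆) τ f
    contract-loop {m} {τ} {f} D loop = record
      { A⊆E    = ∪-least A⊆E ⁅e⁆⊆E
      ; G⊆E    = G─e⊆E
      ; rank   = trans (cong (m +_) loop) (trans rank (cong rk (sym [G─e]∪[A∪e]≡G∪A)))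
      ; rank-≤ = λ X X⊆ → begin
          rk (X ∪ (A ∪ ⁅ e ⁆))      ≡⟨ cong rk (∪-assoc X A ⁅ e ⁆) ⟨
          rk ((X ∪ A) ∪ ⁅ e ⁆)      ≡⟨ Spans-mono (q⊆p∪q X A) (∪-least (⊆-trans X⊆ G─e⊆E) A⊆E) ⁅e⁆⊆E loop ⟩
          rk (X ∪ A)                ≤⟨ rank-≤ X (⊆-trans X⊆ (p─q⊆p G _)) ⟩
          starEdges τ f X + rk A    ≡⟨ cong (starEdges τ f X +_) loop ⟨
          starEdges τ f X + rk (A ∪ ⁅ e ⁆) ∎
      }
      where
      open IsDecomposition D
      open ≤-Reasoning
      ⁅e⁆⊆E : ⁅ e ⁆ ⊆ Eₘ
      ⁅e⁆⊆E = ⁅⁆⊆ (G⊆E e∈G)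
      G─e⊆E : G ─ ⁅ e ⁆ ⊆ Eₘ
      G─e⊆E = ⊆-trans (p─q⊆p G ⁅ e ⁆) G⊆E

    label-≢-root : ∀ {m} {τ : RootedTree m} {f} → IsDecomposition A G τ f →
                   rk (A ∪ ⁅ e ⁆) ≡ suc (rk A) → f e ≢ zero
    label-≢-root {τ = τ} {f} D rk-suc fe≡0 = 1+n≰n (begin
      suc (rk A)                    ≡⟨ rk-suc ⟨
      rk (A ∪ ⁅ e ⁆)                ≡⟨ cong rk (∪-comm A ⁅ e ⁆) ⟩
      rk (⁅ e ⁆ ∪ A)                ≤⟨ rank-≤ ⁅ e ⁆ (⁅⁆⊆ e∈G) ⟩
      starEdges τ f ⁅ e ⁆ + rk A    ≡⟨ cong (_+ rk A) (starEdges-root τ f fe≡0) ⟩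
      rk A                          ∎)
      where
      open IsDecomposition D
      open ≤-Reasoning

    contract-edge : ∀ {k} {τ : RootedTree (suc k)} {f j} → IsDecomposition A G τ f → f e ≡ suc j →
                    rk (A ∪ ⁅ e ⁆) ≡ suc (rk A) →
                    let open EdgeContraction τ j in
                    IsDecomposition (A ∪ ⁅ e ⁆) (G ─ ⁅ e ⁆) contracted (φ ∘ f)
    contract-edge {k} {τ} {f} {j} D fe≡ rk-suc = record
      { A⊆E    = ∪-least A⊆E (⁅⁆⊆ (G⊆E e∈G))
      ; G⊆E    = ⊆-trans (p─q⊆p G _) G⊆E
      ; rank   = begin-equality
          k + rk (A ∪ ⁅ e ⁆)         ≡⟨ cong (k +_) rk-suc ⟩
          k + suc (rk A)             ≡⟨ +-suc k (rk A) ⟩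
          suc k + rk A               ≡⟨ rank ⟩
          rk (G ∪ A)                 ≡⟨ cong rk [G─e]∪[A∪e]≡G∪A ⟨
          rk ((G ─ ⁅ e ⁆) ∪ (A ∪ ⁅ e ⁆)) ∎
      ; rank-≤ = λ X X⊆ → begin
          rk (X ∪ (A ∪ ⁅ e ⁆))       ≤⟨ suc-bound X (⊆-trans X⊆ (p─q⊆p G _)) (j ∈? star τ f X) ⟩
          suc (s′ X + rk A)          ≡⟨ +-suc (s′ X) (rk A) ⟨
          s′ X + suc (rk A)          ≡⟨ cong (s′ X +_) rk-suc ⟨
          s′ X + rk (A ∪ ⁅ e ⁆)      ∎
      }
      where
      open IsDecomposition D
      open EdgeContraction τ j
      open ≤-Reasoning
      s′ : Subset n → ℕ
      s′ = starEdges contracted (φ ∘ f)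
      suc-bound : ∀ X → X ⊆ G → Dec (j ∈ star τ f X) → rk (X ∪ (A ∪ ⁅ e ⁆)) ≤ suc (s′ X + rk A)
      suc-bound X X⊆G (yes j∈) = begin
        rk (X ∪ (A ∪ ⁅ e ⁆))         ≡⟨ cong (λ Z → rk (X ∪ Z)) (∪-comm A ⁅ e ⁆) ⟩
        rk (X ∪ (⁅ e ⁆ ∪ A))         ≡⟨ cong rk (∪-assoc X ⁅ e ⁆ A) ⟨
        rk ((X ∪ ⁅ e ⁆) ∪ A)         ≤⟨ rank-≤ (X ∪ ⁅ e ⁆) (∪-least X⊆G (⁅⁆⊆ e∈G)) ⟩
        starEdges τ f (X ∪ ⁅ e ⁆) + rk A ≤⟨ +-monoˡ-≤ (rk A) (p⊆q⇒∣p∣≤∣q∣ (star-absorb τ f {X} j∈ fe≡)) ⟩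
        starEdges τ f X + rk A       ≤⟨ +-monoˡ-≤ (rk A) (starEdges-contracted f X) ⟩
        suc (s′ X + rk A)            ∎
      suc-bound X X⊆G (no j∉) = begin
        rk (X ∪ (A ∪ ⁅ e ⁆))         ≡⟨ cong rk (∪-assoc X A ⁅ e ⁆) ⟨
        rk ((X ∪ A) ∪ ⁅ e ⁆)         ≤⟨ rk-∪-⁅⁆-≤ (∪-least (⊆-trans X⊆G G⊆E) A⊆E) (G⊆E e∈G) ⟩
        suc (rk (X ∪ A))             ≤⟨ s≤s (rank-≤ X X⊆G) ⟩
        suc (starEdges τ f X + rk A) ≤⟨ s≤s (+-monoˡ-≤ (rk A) (starEdges-contracted-∉ f X j∉)) ⟩
        suc (s′ X + rk A)            ∎

    contract-nonloop : ∀ {d} → Decomposable d A G → rk (A ∪ ⁅ e ⁆) ≡ suc (rk A) →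
                       Decomposable d (A ∪ ⁅ e ⁆) (G ─ ⁅ e ⁆)
    contract-nonloop {d} (decomposition τ f D depth≤) rk-suc = contract-at τ f D depth≤ (f e) refl
      where
      contract-at : ∀ {m} (τ : RootedTree m) f → IsDecomposition A G τ f → depth τ ≤ d →
                    ∀ v → f e ≡ v → Decomposable d (A ∪ ⁅ e ⁆) (G ─ ⁅ e ⁆)
      contract-at τ f D _ zero fe≡0 = ⊥-elim (label-≢-root D rk-suc fe≡0)
      contract-at {suc k} τ f D depth≤ (suc j) fe≡ =
        decomposition contracted (φ ∘ f) (contract-edge D fe≡ rk-suc) (≤-trans depth-contracted depth≤)
        where open EdgeContraction τ j

    contract : ∀ {d} → Decomposable d A G → Decomposable d (A ∪ ⁅ e ⁆) (G ─ ⁅ e ⁆)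
    contract (decomposition τ f D depth≤) with rk (A ∪ ⁅ e ⁆) ≟ℕ rk A
    ... | yes loop = decomposition τ f (contract-loop D loop) depth≤
    ... | no ¬loop = contract-nonloop (decomposition τ f D depth≤)
                       (¬Spans⇒rk-suc (IsDecomposition.A⊆E D) (IsDecomposition.G⊆E D e∈G) ¬loop)

    coloop-rk : ∀ {Z} → A ⊆ Eₘ → G ⊆ Eₘ → rk ((G ─ ⁅ e ⁆) ∪ A) ≢ rk (G ∪ A) →
                Z ⊆ (G ─ ⁅ e ⁆) ∪ A → rk (Z ∪ ⁅ e ⁆) ≡ suc (rk Z)
    coloop-rk A⊆E G⊆E coloop Z⊆ = ¬Spans⇒rk-suc (⊆-trans Z⊆ [G─e]∪A⊆E) (G⊆E e∈G)
      λ Z-spans → coloop (sym (trans (cong rk G∪A≡) (Spans-mono Z⊆ [G─e]∪A⊆E (⁅⁆⊆ (G⊆E e∈G)) Z-spans)))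
      where
      [G─e]∪A⊆E : (G ─ ⁅ e ⁆) ∪ A ⊆ Eₘ
      [G─e]∪A⊆E = ∪-least (⊆-trans (p─q⊆p G _) G⊆E) A⊆E
      G∪A≡ : G ∪ A ≡ ((G ─ ⁅ e ⁆) ∪ A) ∪ ⁅ e ⁆
      G∪A≡ = trans (sym [G─e]∪[A∪e]≡G∪A) (sym (∪-assoc _ A ⁅ e ⁆))

  delete-noncoloop : ∀ {A G e m} {τ : RootedTree m} {f} → IsDecomposition A G τ f →
                     rk ((G ─ ⁅ e ⁆) ∪ A) ≡ rk (G ∪ A) → IsDecomposition A (G ─ ⁅ e ⁆) τ f
  delete-noncoloop {G = G} D same-rank = record
    { A⊆E    = A⊆E
    ; G⊆E    = ⊆-trans (p─q⊆p G _) G⊆E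
    ; rank   = trans rank (sym same-rank)
    ; rank-≤ = λ X X⊆ → rank-≤ X (⊆-trans X⊆ (p─q⊆p G _))
    }
    where open IsDecomposition D

  -- (M / B) | G = (M / A) | G: on subsets of G, X ↦ rk (X ∪ A) and
  -- X ↦ rk (X ∪ B) differ by a constant.
  SameMinor : Subset n → Subset n → Subset n → Set
  SameMinor G B A = ∃[ c ] ∀ X → X ⊆ G → rk (X ∪ A) ≡ rk (X ∪ B) + c

  SameMinor-refl : ∀ {G A} → SameMinor G A A
  SameMinor-refl = 0 , λ X _ → sym (+-identityʳ _)

  SameMinor-trans : ∀ {G B A A′} → SameMinor G B A → SameMinor G A A′ → SameMinor G B A′
  SameMinor-trans (c , shift) (c′ , shift′) =
    c + c′ , λ X X⊆ → trans (shift′ X X⊆) (trans (cong (_+ c′) (shift X X⊆)) (+-assoc _ c c′))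

  SameMinor-restrict : ∀ {G G′ B A} → G′ ⊆ G → SameMinor G B A → SameMinor G′ B A
  SameMinor-restrict G′⊆G (c , shift) = c , λ X X⊆ → shift X (⊆-trans X⊆ G′⊆G)

  delete : ∀ {d A G e} → e ∈ G → Decomposable d A G →
           ∃[ A′ ] SameMinor (G ─ ⁅ e ⁆) A A′ × Decomposable d A′ (G ─ ⁅ e ⁆)
  delete {A = A} {G} {e} e∈G (decomposition τ f D depth≤) with rk ((G ─ ⁅ e ⁆) ∪ A) ≟ℕ rk (G ∪ A)
  ... | yes same-rank = A , SameMinor-refl , decomposition τ f (delete-noncoloop D same-rank) depth≤
  ... | no coloop =
    A ∪ ⁅ e ⁆ ,
    (1 , λ X X⊆ → begin
      rk (X ∪ (A ∪ ⁅ e ⁆)) ≡⟨ cong rk (∪-assoc X A ⁅ e ⁆) ⟨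
      rk ((X ∪ A) ∪ ⁅ e ⁆) ≡⟨ coloop-rk′ (∪-least (⊆-trans X⊆ (p⊆p∪q A)) (q⊆p∪q _ A)) ⟩
      suc (rk (X ∪ A))     ≡⟨ +-comm 1 _ ⟩
      rk (X ∪ A) + 1       ∎) ,
    contract-nonloop e∈G (decomposition τ f D depth≤) (coloop-rk′ (q⊆p∪q _ A))
    where
    open ≡-Reasoning
    coloop-rk′ : ∀ {Z} → Z ⊆ (G ─ ⁅ e ⁆) ∪ A → rk (Z ∪ ⁅ e ⁆) ≡ suc (rk Z)
    coloop-rk′ = coloop-rk e∈G (IsDecomposition.A⊆E D) (IsDecomposition.G⊆E D) coloop

  contractAll : ∀ {d C} → C ⊆ Eₘ → Decomposable d ⊥ Eₘ → Decomposable d C (Eₘ ─ C)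
  contractAll {d} {C} C⊆E D = subst (λ A → Decomposable d A (Eₘ ─ C)) (p─[p─q]≡q C⊆E)
    (─-rec C (λ G → Decomposable d (Eₘ ─ G) G) step (subst (λ A → Decomposable d A Eₘ) ⊥≡E─E D))
    where
    ⊥≡E─E : ⊥ ≡ Eₘ ─ Eₘ
    ⊥≡E─E = trans (sym (p─[p─q]≡q ⊥⊆)) (cong (Eₘ ─_) (p─⊥≡p Eₘ))
    step : ∀ {G e} → e ∈ G → e ∈ C →
           Decomposable d (Eₘ ─ G) G → Decomposable d (Eₘ ─ (G ─ ⁅ e ⁆)) (G ─ ⁅ e ⁆)
    step {G} {e} e∈G _ D =
      subst (λ A → Decomposable d A (G ─ ⁅ e ⁆)) ([p─q]∪⁅e⁆≡p─[q─⁅e⁆] G⊆E e∈G) (contract e∈G D)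
      where
      G⊆E : G ⊆ Eₘ
      G⊆E = IsDecomposition.G⊆E (Decomposable.isDecomposition D)

  deleteAll : ∀ {d B G} S → Decomposable d B G → ∃[ A ] SameMinor (G ─ S) B A × Decomposable d A (G ─ S)
  deleteAll {d} {B} S D = ─-rec S (λ G → ∃[ A ] SameMinor G B A × Decomposable d A G) step
                                    (B , SameMinor-refl , D)
    where
    step : ∀ {G e} → e ∈ G → e ∈ S → ∃[ A ] SameMinor G B A × Decomposable d A G →
           ∃[ A ] SameMinor (G ─ ⁅ e ⁆) B A × Decomposable d A (G ─ ⁅ e ⁆)
    step e∈G _ (A , same , D) with delete e∈G D
    ... | A′ , same′ , D′ = A′ , SameMinor-trans (SameMinor-restrict (p─q⊆p _ _) same) same′ , D′

  IsDepthDecomposition⇒Decomposable : ∀ {m} {τ : RootedTree m} {f} →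
                                      IsDepthDecomposition M τ f → Decomposable (depth τ) ⊥ Eₘ
  IsDepthDecomposition⇒Decomposable {m} {τ} {f} (rk-E , rk-≤) = decomposition τ f (record
    { A⊆E    = ⊥⊆
    ; G⊆E    = id
    ; rank   = trans (+-rk-⊥ m) (sym (trans (cong rk (∪-identityʳ Eₘ)) rk-E))
    ; rank-≤ = λ X X⊆E → subst₂ _≤_ (cong rk (sym (∪-identityʳ X))) (sym (+-rk-⊥ _)) (rk-≤ X X⊆E)
    }) ≤-refl
    where
    +-rk-⊥ : ∀ k → k + rk ⊥ ≡ k
    +-rk-⊥ k = trans (cong (k +_) rk-⊥) (+-identityʳ k)

  minor-isDepthDecomposition : ∀ {C A G m} {τ : RootedTree m} {f} (M′ : Matroid n) → E M′ ≡ G →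
    (∀ X → X ⊆ E M′ → r M′ X ≡ rk (X ∪ C) ∸ rk C) →
    IsDecomposition A G τ f → SameMinor G C A → IsDepthDecomposition M′ τ f
  minor-isDepthDecomposition {C} {A} {G} {m} {τ} {f} M′ refl r′≡ D (c , shift) = rank′ , rank-≤′
    where
    open IsDecomposition D
    rk-A : rk A ≡ rk C + c
    rk-A = subst₂ (λ A′ C′ → rk A′ ≡ rk C′ + c) (∪-identityˡ A) (∪-identityˡ C) (shift ⊥ ⊥⊆)
    rank′ : r M′ G ≡ m
    rank′ = begin
      r M′ G                      ≡⟨ r′≡ G id ⟩
      rk (G ∪ C) ∸ rk C           ≡⟨ cong (_∸ rk C) (+-cancelʳ-≡ c _ _ (begin
        rk (G ∪ C) + c              ≡⟨ shift G id ⟨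
        rk (G ∪ A)                  ≡⟨ rank ⟨
        m + rk A                    ≡⟨ cong (m +_) rk-A ⟩
        m + (rk C + c)              ≡⟨ +-assoc m (rk C) c ⟨
        m + rk C + c                ∎)) ⟩
      m + rk C ∸ rk C             ≡⟨ m+n∸n≡m m (rk C) ⟩
      m                           ∎
      where open ≡-Reasoning
    rank-≤′ : ∀ X → X ⊆ G → r M′ X ≤ starEdges τ f X
    rank-≤′ X X⊆G = subst (_≤ starEdges τ f X) (sym (r′≡ X X⊆G)) (m≤n+o⇒m∸n≤o (rk (X ∪ C)) (rk C)
      (+-cancelʳ-≤ c _ _ (begin
        rk (X ∪ C) + c              ≡⟨ shift X X⊆G ⟨
        rk (X ∪ A)                  ≤⟨ rank-≤ X X⊆G ⟩
        starEdges τ f X + rk A      ≡⟨ cong (starEdges τ f X +_) rk-A ⟩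
        starEdges τ f X + (rk C + c) ≡⟨ +-assoc (starEdges τ f X) (rk C) c ⟨
        starEdges τ f X + rk C + c   ≡⟨ cong (_+ c) (+-comm (starEdges τ f X) (rk C)) ⟩
        rk C + starEdges τ f X + c   ∎)))
      where open ≤-Reasoning

proposition8 : ∀ {n} (M M' : Matroid n) (d d' : ℕ) →
    IsMinor M' M → IsBranchDepth M d → IsBranchDepth M' d' → d' ≤ d
proposition8 M M' d d' (C , D , C⊆E , _ , _ , E'≡ , r'≡) ((_ , τ , f , isDD , refl) , _) (_ , least') =
  let A , same , decomposition τ′ f′ D′ depth≤ =
        deleteAll M D (contractAll M C⊆E (IsDepthDecomposition⇒Decomposable M isDD))
  in ≤-trans (least' _ τ′ f′ (minor-isDepthDecomposition M M' E'≡C─D r'≡ D′ same)) depth≤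
  where
  E'≡C─D : E M' ≡ E M ─ C ─ D
  E'≡C─D = trans E'≡ (sym (p─q─r≡p─q∪r (E M) C D))
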